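{- The infinite-rank plactic monoid $\mathsf{plac}$ does not satisfy any non-trivial identity.
   Context: An identity is a formal equality $u = v$ between two words $u,v$ in a free monoid over a set of variables; it is non-trivial if $u \neq v$ as words. A monoid $M$ satisfies the identity if the equality holds in $M$ under every substitution of the variables by elements of $M$. Let $\mathcal{A} = \{1 < 2 < 3 < \dots\}$ be the natural numbers viewed as an infinite ordered alphabet. The plactic monoid $\mathsf{plac}$ is the quotient of the free monoid $\mathcal{A}^*$ by the plactic (Knuth) congruence, i.e. the congruence generated by the relations $zxy = xzy$ for letters $x \le y < z$ and $yxz = yzx$ for letters $x < y \le z$ (equivalently, words are congruent iff Schensted's algorithm yields the same Young tableau). -}

module Defs where

open import Data.Nat using (ℕ; _≤_; _<_)
open import Data.List using (List; []; _∷_; _++_; concatMap)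

-- The infinite ordered alphabet A = {1 < 2 < 3 < ...}; we index letters by ℕ
-- (letter i+1 is represented by i), with the usual order, an order isomorphism.
Letter : Set
Letter = ℕ

Word : Set
Word = List Letter

infix 4 _≈ₚ_
data _≈ₚ_ : Word → Word → Set where
  knuth₁ : ∀ {x y z} → x ≤ y → y < z → (p q : Word) →
           (p ++ z ∷ x ∷ y ∷ q) ≈ₚ (p ++ x ∷ z ∷ y ∷ q)
  knuth₂ : ∀ {x y z} → x < y → y ≤ z → (p q : Word) →
           (p ++ y ∷ x ∷ z ∷ q) ≈ₚ (p ++ y ∷ z ∷ x ∷ q)
  ≈-refl  : ∀ {w} → w ≈ₚ w
  ≈-sym   : ∀ {u v} → u ≈ₚ v → v ≈ₚ u
  ≈-trans : ∀ {u v w} → u ≈ₚ v → v ≈ₚ w → u ≈ₚ w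

Var : Set
Var = ℕ

evalW : (Var → Word) → List Var → Word
evalW σ w = concatMap σ w

PlacSatisfies : List Var → List Var → Set
PlacSatisfies u v = ∀ (σ : Var → Word) → evalW σ u ≈ₚ evalW σ v

-- Both the length of a word and, for every bound i, the length lds i of its longest strictly
-- decreasing subsequence of letters below i are invariant under the Knuth relations.  Let u ≠ v.
-- If their lengths differ, substituting one letter for every variable separates them.
-- Otherwise u = w x u', v = w y v' with x ≠ y; if y occurs differently often in u and v,
-- substituting a letter for y and the empty word for the other variables separates them
-- by length.  So let the numbers of y agree, let a be the number of x in w and N that of y
-- in u', and substitute x ↦ N, N+1, …, N+a and y ↦ 0, 1, …, N−1 (other variables ↦ empty).
-- The image of u contains the decreasing word N+a, …, N, N−1, …, 0 of length N+a+1: one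
-- letter from each of the first a+1 x-blocks, then one from each y-block of u'.  In the image
-- of v a decreasing subsequence takes at most one letter from each block, its letters ≥ N from
-- x-blocks before its letters < N from y-blocks; it either stays inside w for the former (at
-- most a of them) or only has the N−1 y-blocks of v' for the latter, so it is never longer
-- than N+a.
module Submission where

open import Data.List using (List; []; _∷_; _++_; length)
open import Data.List.Properties using (++-assoc; length-++; concatMap-++)
open import Data.Nat
open import Data.Nat.Properties
open import Data.Sum using (inj₁; inj₂)
open import Relation.Binary.PropositionalEquality
open import Function using (_∘_)
open import Relation.Nullary using (¬_; yes; no; contradiction)
open import Algebra.Properties.CommutativeSemigroup ⊔-commutativeSemigroup using (x∙yz≈y∙xz)

open import Defs

⊔-absorbs-≤ : ∀ {a b} c → b ≤ a → a ⊔ c ≡ a ⊔ (b ⊔ c)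
⊔-absorbs-≤ {a} {b} c b≤a = begin
  a ⊔ c         ≡⟨ cong (_⊔ c) (m≥n⇒m⊔n≡m b≤a) ⟨
  (a ⊔ b) ⊔ c   ≡⟨ ⊔-assoc a b c ⟩
  a ⊔ (b ⊔ c)   ∎
  where open ≡-Reasoning

-- lds i w is the length of a longest strictly decreasing subsequence of w
-- all of whose letters are smaller than i.
lds : Letter → Word → ℕ
lds i []      = 0
lds i (a ∷ w) with a <? i
... | yes _ = suc (lds a w) ⊔ lds i w
... | no  _ = lds i w

lds-∷-< : ∀ {a i} w → a < i → lds i (a ∷ w) ≡ suc (lds a w) ⊔ lds i w
lds-∷-< {a} {i} w a<i with a <? i
... | yes _   = refl
... | no  a≮i = contradiction a<i a≮i

lds-∷-≥ : ∀ {a i} w → i ≤ a → lds i (a ∷ w) ≡ lds i w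
lds-∷-≥ {a} {i} w i≤a with a <? i
... | yes a<i = contradiction i≤a (<⇒≱ a<i)
... | no  _   = refl

lds-∷-head : ∀ {a i} w → a < i → suc (lds a w) ≤ lds i (a ∷ w)
lds-∷-head {a} {i} w a<i = ≤-trans (m≤m⊔n _ (lds i w)) (≤-reflexive (sym (lds-∷-< w a<i)))

lds-∷-tail : ∀ i a w → lds i w ≤ lds i (a ∷ w)
lds-∷-tail i a w with a <? i
... | yes _ = m≤n⊔m _ _
... | no  _ = ≤-refl

lds-∷-lub : ∀ i a w {M} → (a < i → suc (lds a w) ≤ M) → lds i w ≤ M → lds i (a ∷ w) ≤ M
lds-∷-lub i a w head tail with a <? i
... | yes a<i = ⊔-lub (head a<i) tail
... | no  _   = tail

lds-∷-cong : ∀ i a s s' → lds a s ≡ lds a s' → lds i s ≡ lds i s' →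
             lds i (a ∷ s) ≡ lds i (a ∷ s')
lds-∷-cong i a s s' eqᵃ eqⁱ with a <? i
... | yes _ = cong₂ (λ m n → suc m ⊔ n) eqᵃ eqⁱ
... | no  _ = eqⁱ

lds-≤-bound : ∀ i w → lds i w ≤ i
lds-≤-bound i []      = z≤n
lds-≤-bound i (a ∷ w) =
  lds-∷-lub i a w (λ a<i → ≤-trans (s≤s (lds-≤-bound a w)) a<i) (lds-≤-bound i w)

lds-mono : ∀ {i j} w → i ≤ j → lds i w ≤ lds j w
lds-mono         []      _   = z≤n
lds-mono {i} {j} (a ∷ w) i≤j = lds-∷-lub i a w
  (λ a<i → lds-∷-head w (<-≤-trans a<i i≤j))
  (≤-trans (lds-mono w i≤j) (lds-∷-tail j a w))

lds-++-suffix : ∀ i r t → lds i t ≤ lds i (r ++ t)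
lds-++-suffix i []      t = ≤-refl
lds-++-suffix i (a ∷ r) t = ≤-trans (lds-++-suffix i r t) (lds-∷-tail i a (r ++ t))

lds-∷-redundant : ∀ i a w → suc (lds a w) ≤ lds i w → lds i (a ∷ w) ≡ lds i w
lds-∷-redundant i a w bound = ≤-antisym (lds-∷-lub i a w (λ _ → bound) ≤-refl) (lds-∷-tail i a w)

lds-absorb : ∀ {x y j} w → x ≤ y → y < j → lds j (x ∷ y ∷ w) ≡ lds j (y ∷ w)
lds-absorb {x} {y} {j} w x≤y y<j = lds-∷-redundant j x (y ∷ w) (begin
  suc (lds x (y ∷ w))  ≡⟨ cong suc (lds-∷-≥ w x≤y) ⟩
  suc (lds x w)        ≤⟨ s≤s (lds-mono w x≤y) ⟩
  suc (lds y w)        ≤⟨ lds-∷-head w y<j ⟩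
  lds j (y ∷ w)        ∎)
  where open ≤-Reasoning

lds-swap-≥ : ∀ {x z j} w → j ≤ z → x ≤ z → lds j (x ∷ z ∷ w) ≡ lds j (z ∷ x ∷ w)
lds-swap-≥ {x} {z} {j} w j≤z x≤z =
  trans (lds-∷-cong j x (z ∷ w) w (lds-∷-≥ w x≤z) (lds-∷-≥ w j≤z)) (sym (lds-∷-≥ (x ∷ w) j≤z))

lds-swap-< : ∀ {x z i} w → x < z → z < i →
             lds i (z ∷ x ∷ w) ≡ suc (suc (lds x w)) ⊔ lds i (x ∷ z ∷ w)
lds-swap-< {x} {z} {i} w x<z z<i = begin
  lds i (z ∷ x ∷ w)
    ≡⟨ lds-∷-< (x ∷ w) z<i ⟩
  suc (lds z (x ∷ w)) ⊔ lds i (x ∷ w)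
    ≡⟨ cong₂ (λ m n → suc m ⊔ n) (lds-∷-< w x<z) (lds-∷-< w x<i) ⟩
  (suc (suc f) ⊔ suc g) ⊔ (suc f ⊔ h)
    ≡⟨ ⊔-assoc (suc (suc f)) (suc g) (suc f ⊔ h) ⟩
  suc (suc f) ⊔ (suc g ⊔ (suc f ⊔ h))
    ≡⟨ cong (suc (suc f) ⊔_) (x∙yz≈y∙xz (suc g) (suc f) h) ⟩
  suc (suc f) ⊔ (suc f ⊔ (suc g ⊔ h))
    ≡⟨ cong₂ (λ m n → suc (suc f) ⊔ (suc m ⊔ n)) (lds-∷-≥ w (<⇒≤ x<z)) (lds-∷-< w z<i) ⟨
  suc (suc f) ⊔ (suc (lds x (z ∷ w)) ⊔ lds i (z ∷ w))
    ≡⟨ cong (suc (suc f) ⊔_) (lds-∷-< (z ∷ w) x<i) ⟨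
  suc (suc f) ⊔ lds i (x ∷ z ∷ w)
    ∎
  where
  open ≡-Reasoning
  x<i = <-trans x<z z<i
  f = lds x w
  g = lds z w
  h = lds i w

lds-knuth₁ : ∀ {x y z} → x ≤ y → y < z → ∀ q i →
             lds i (z ∷ x ∷ y ∷ q) ≡ lds i (x ∷ z ∷ y ∷ q)
lds-knuth₁ {x} {y} {z} x≤y y<z q i with i ≤? z
... | yes i≤z = begin
  lds i (z ∷ x ∷ y ∷ q)  ≡⟨ lds-∷-≥ (x ∷ y ∷ q) i≤z ⟩
  lds i (x ∷ y ∷ q)      ≡⟨ lds-∷-cong i x (y ∷ q) (z ∷ y ∷ q)
                              (sym (lds-∷-≥ (y ∷ q) x≤z)) (sym (lds-∷-≥ (y ∷ q) i≤z)) ⟩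
  lds i (x ∷ z ∷ y ∷ q)  ∎
  where
  open ≡-Reasoning
  x≤z = ≤-trans x≤y (<⇒≤ y<z)
... | no i≰z = begin
  lds i (z ∷ x ∷ y ∷ q)
    ≡⟨ lds-∷-< (x ∷ y ∷ q) z<i ⟩
  suc (lds z (x ∷ y ∷ q)) ⊔ lds i (x ∷ y ∷ q)
    ≡⟨ cong₂ (λ m n → suc m ⊔ n) (lds-absorb q x≤y y<z) (lds-absorb q x≤y (<-trans y<z z<i)) ⟩
  suc (lds z (y ∷ q)) ⊔ lds i (y ∷ q)
    ≡⟨ lds-∷-< (y ∷ q) z<i ⟨
  lds i (z ∷ y ∷ q)
    ≡⟨ lds-absorb (y ∷ q) (≤-trans x≤y (<⇒≤ y<z)) z<i ⟨
  lds i (x ∷ z ∷ y ∷ q)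
    ∎
  where
  open ≡-Reasoning
  z<i = ≰⇒> i≰z

lds-knuth₂ : ∀ {x y z} → x < y → y ≤ z → ∀ q i →
             lds i (y ∷ x ∷ z ∷ q) ≡ lds i (y ∷ z ∷ x ∷ q)
lds-knuth₂ {x} {y} {z} x<y y≤z q i with i ≤? z
... | yes i≤z =
  lds-∷-cong i y (x ∷ z ∷ q) (z ∷ x ∷ q) (lds-swap-≥ q y≤z x≤z) (lds-swap-≥ q i≤z x≤z)
  where x≤z = <⇒≤ (<-≤-trans x<y y≤z)
... | no i≰z = begin
  lds i (y ∷ x ∷ z ∷ q)
    ≡⟨ lds-∷-< (x ∷ z ∷ q) y<i ⟩
  suc (lds y (x ∷ z ∷ q)) ⊔ lds i (x ∷ z ∷ q)
    ≡⟨ cong (λ m → suc m ⊔ lds i (x ∷ z ∷ q)) (lds-swap-≥ q y≤z (<⇒≤ x<z)) ⟩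
  suc P ⊔ lds i (x ∷ z ∷ q)
    ≡⟨ ⊔-absorbs-≤ (lds i (x ∷ z ∷ q)) (s≤s xy-below-P) ⟩
  suc P ⊔ (suc (suc (lds x q)) ⊔ lds i (x ∷ z ∷ q))
    ≡⟨ cong (suc P ⊔_) (lds-swap-< q x<z z<i) ⟨
  suc P ⊔ lds i (z ∷ x ∷ q)
    ≡⟨ lds-∷-< (z ∷ x ∷ q) y<i ⟨
  lds i (y ∷ z ∷ x ∷ q)
    ∎
  where
  open ≡-Reasoning
  z<i = ≰⇒> i≰z
  y<i = ≤-<-trans y≤z z<i
  x<z = <-≤-trans x<y y≤z
  P = lds y (z ∷ x ∷ q)
  xy-below-P : suc (lds x q) ≤ P
  xy-below-P = ≤-trans (lds-∷-head q x<y) (≤-reflexive (sym (lds-∷-≥ (x ∷ q) y≤z)))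

lds-++ˡ-cong : ∀ p {s s'} → (∀ j → lds j s ≡ lds j s') → ∀ i → lds i (p ++ s) ≡ lds i (p ++ s')
lds-++ˡ-cong []      eq i = eq i
lds-++ˡ-cong (a ∷ p) {s} {s'} eq i =
  lds-∷-cong i a (p ++ s) (p ++ s') (lds-++ˡ-cong p eq a) (lds-++ˡ-cong p eq i)

lds-resp-≈ₚ : ∀ {u v} → u ≈ₚ v → ∀ i → lds i u ≡ lds i v
lds-resp-≈ₚ (knuth₁ x≤y y<z p q) = lds-++ˡ-cong p (lds-knuth₁ x≤y y<z q)
lds-resp-≈ₚ (knuth₂ x<y y≤z p q) = lds-++ˡ-cong p (lds-knuth₂ x<y y≤z q)
lds-resp-≈ₚ ≈-refl        i = refl
lds-resp-≈ₚ (≈-sym e)     i = sym (lds-resp-≈ₚ e i)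
lds-resp-≈ₚ (≈-trans e f) i = trans (lds-resp-≈ₚ e i) (lds-resp-≈ₚ f i)

length-resp-≈ₚ : ∀ {u v} → u ≈ₚ v → length u ≡ length v
length-resp-≈ₚ (knuth₁ _ _ p _) = trans (length-++ p) (sym (length-++ p))
length-resp-≈ₚ (knuth₂ _ _ p _) = trans (length-++ p) (sym (length-++ p))
length-resp-≈ₚ ≈-refl           = refl
length-resp-≈ₚ (≈-sym e)        = sym (length-resp-≈ₚ e)
length-resp-≈ₚ (≈-trans e f)    = trans (length-resp-≈ₚ e) (length-resp-≈ₚ f)

row : ℕ → ℕ → Word
row c zero    = []
row c (suc k) = c ∷ row (suc c) k

lds-row-≥ : ∀ {i c} k t → i ≤ c → lds i (row c k ++ t) ≡ lds i t
lds-row-≥ zero    t _   = refl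
lds-row-≥ (suc k) t i≤c = trans (lds-∷-≥ _ i≤c) (lds-row-≥ k t (m≤n⇒m≤1+n i≤c))

lds-row-lower : ∀ {c e i} k t → c ≤ e → e < c + k → e < i →
                suc (lds e t) ≤ lds i (row c k ++ t)
lds-row-lower {c} {e} zero t c≤e e<c+0 _ =
  contradiction (subst (e <_) (+-identityʳ c) e<c+0) (≤⇒≯ c≤e)
lds-row-lower {c} {e} {i} (suc k) t c≤e e<c+k e<i with m≤n⇒m<n∨m≡n c≤e
... | inj₁ c<e = ≤-trans (lds-row-lower k t c<e (subst (e <_) (+-suc c k) e<c+k) e<i)
                         (lds-∷-tail i c (row (suc c) k ++ t))
... | inj₂ refl = begin
  suc (lds c t)                     ≡⟨ cong suc (lds-row-≥ k t (n≤1+n c)) ⟨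
  suc (lds c (row (suc c) k ++ t))  ≤⟨ lds-∷-head (row (suc c) k ++ t) e<i ⟩
  lds i (row c (suc k) ++ t)        ∎
  where open ≤-Reasoning

lds-row-upper : ∀ {M} c k i t → (∀ {e} → c ≤ e → e < c + k → e < i → suc (lds e t) ≤ M) →
                lds i t ≤ M → lds i (row c k ++ t) ≤ M
lds-row-upper c zero i t _ base = base
lds-row-upper {M} c (suc k) i t bound base =
  lds-∷-lub i c (row (suc c) k ++ t) head (lds-row-upper (suc c) k i t bound′ base)
  where
  head : c < i → suc (lds c (row (suc c) k ++ t)) ≤ M
  head c<i = subst (λ n → suc n ≤ M) (sym (lds-row-≥ k t (n≤1+n c)))
                   (bound ≤-refl (m<m+n c z<s) c<i)
  bound′ : ∀ {e} → suc c ≤ e → e < suc c + k → e < i → suc (lds e t) ≤ M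
  bound′ {e} c<e e<c+k = bound (<⇒≤ c<e) (subst (e <_) (sym (+-suc c k)) e<c+k)

suc-⊔-pred-mono : ∀ m {j c} → j < c → suc (m ⊔ pred j) ≤ suc m ⊔ pred c
suc-⊔-pred-mono m {zero}  {suc c} _         =
  ⊔-lub (m≤m⊔n (suc m) c) (≤-trans (s≤s z≤n) (m≤m⊔n (suc m) c))
suc-⊔-pred-mono m {suc j} {suc c} (s≤s j<c) = ⊔-monoʳ-≤ (suc m) j<c

+-≤-suc-+-pred : ∀ c m → c + m ≤ suc m + pred c
+-≤-suc-+-pred zero    m = m≤n⇒m≤1+n (m≤m+n m 0)
+-≤-suc-+-pred (suc c) m = s≤s (≤-reflexive (+-comm c m))

data Kind : Set where
  is-x is-y other : Kind

module TwoVariables (x y : Var) where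

  kind : Var → Kind
  kind z with z ≟ x
  ... | yes _ = is-x
  ... | no  _ with z ≟ y
  ...   | yes _ = is-y
  ...   | no  _ = other

  kind-x : kind x ≡ is-x
  kind-x with x ≟ x
  ... | yes _   = refl
  ... | no  x≢x = contradiction refl x≢x

  kind-y : x ≢ y → kind y ≡ is-y
  kind-y x≢y with y ≟ x
  ... | yes y≡x = contradiction (sym y≡x) x≢y
  ... | no  _ with y ≟ y
  ...   | yes _   = refl
  ...   | no  y≢y = contradiction refl y≢y

  #x : List Var → ℕ
  #x []      = 0
  #x (z ∷ s) with kind z
  ... | is-x  = suc (#x s)
  ... | is-y  = #x s
  ... | other = #x s

  #y : List Var → ℕ
  #y []      = 0
  #y (z ∷ s) with kind z
  ... | is-x  = #y s
  ... | is-y  = suc (#y s)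
  ... | other = #y s

  #x-++ : ∀ s s' → #x (s ++ s') ≡ #x s + #x s'
  #x-++ []      s' = refl
  #x-++ (z ∷ s) s' with kind z
  ... | is-x  = cong suc (#x-++ s s')
  ... | is-y  = #x-++ s s'
  ... | other = #x-++ s s'

  #y-++ : ∀ s s' → #y (s ++ s') ≡ #y s + #y s'
  #y-++ []      s' = refl
  #y-++ (z ∷ s) s' with kind z
  ... | is-x  = #y-++ s s'
  ... | is-y  = cong suc (#y-++ s s')
  ... | other = #y-++ s s'

  #x-∷ʳ-x : ∀ s → #x (s ++ x ∷ []) ≡ suc (#x s)
  #x-∷ʳ-x s rewrite #x-++ s (x ∷ []) | kind-x = +-comm (#x s) 1

  #y-x∷ : ∀ s → #y (x ∷ s) ≡ #y s
  #y-x∷ s rewrite kind-x = refl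

  #y-y∷ : x ≢ y → ∀ s → #y (y ∷ s) ≡ suc (#y s)
  #y-y∷ x≢y s rewrite kind-y x≢y = refl

  y-marker : Var → Word
  y-marker z with kind z
  ... | is-y = 0 ∷ []
  ... | _    = []

  length-y-marker : ∀ s → length (evalW y-marker s) ≡ #y s
  length-y-marker []      = refl
  length-y-marker (z ∷ s) with kind z
  ... | is-x  = length-y-marker s
  ... | is-y  = cong suc (length-y-marker s)
  ... | other = length-y-marker s

  #y-agree : ∀ u v → PlacSatisfies u v → #y u ≡ #y v
  #y-agree u v sat =
    trans (sym (length-y-marker u)) (trans (length-resp-≈ₚ (sat y-marker)) (length-y-marker v))

  module Witness (a N : ℕ) where

    σ : Var → Word
    σ z with kind z
    ... | is-x  = row N (suc a)
    ... | is-y  = row 0 N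
    ... | other = []

    σ-y : x ≢ y → σ y ≡ row 0 N
    σ-y x≢y rewrite kind-y x≢y = refl

    lds-σ-lower-x : ∀ s c t → c ≤ #x s → c ≤ suc a →
                    c + lds N t ≤ lds (N + c) (evalW σ s ++ t)
    lds-σ-lower-x s zero t _ _ =
      subst (λ i → lds N t ≤ lds i (evalW σ s ++ t)) (sym (+-identityʳ N))
            (lds-++-suffix N (evalW σ s) t)
    lds-σ-lower-x (z ∷ s) (suc c) t c<#x c<a rewrite ++-assoc (σ z) (evalW σ s) t with kind z
    ... | is-x  = ≤-trans (s≤s (lds-σ-lower-x s c t (s≤s⁻¹ c<#x) (<⇒≤ c<a)))
                          (lds-row-lower (suc a) _ (m≤m+n N c) (+-monoʳ-< N c<a) (+-monoʳ-< N ≤-refl))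
    ... | is-y  = ≤-trans (lds-σ-lower-x s (suc c) t c<#x c<a)
                          (lds-++-suffix (N + suc c) (row 0 N) (evalW σ s ++ t))
    ... | other = lds-σ-lower-x s (suc c) t c<#x c<a

    lds-σ-lower-y : ∀ s c → c ≤ #y s → c ≤ N → c ≤ lds c (evalW σ s)
    lds-σ-lower-y s       zero    _ _ = z≤n
    lds-σ-lower-y (z ∷ s) (suc c) c<#y c<N with kind z
    ... | is-x  = ≤-trans (lds-σ-lower-y s (suc c) c<#y c<N)
                          (lds-++-suffix (suc c) (row N (suc a)) (evalW σ s))
    ... | is-y  = ≤-trans (s≤s (lds-σ-lower-y s c (s≤s⁻¹ c<#y) (<⇒≤ c<N)))
                          (lds-row-lower N _ z≤n c<N ≤-refl)
    ... | other = lds-σ-lower-y s (suc c) c<#y c<N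

    lds-σ-upper : ∀ s i → lds i (evalW σ s) ≤ (i ∸ N) + #y s
    lds-σ-upper []      i = z≤n
    lds-σ-upper (z ∷ s) i with kind z
    ... | is-x  = lds-row-upper N (suc a) i (evalW σ s)
                    (λ {e} N≤e _ e<i → ≤-trans (s≤s (lds-σ-upper s e))
                                               (+-monoˡ-≤ (#y s) (∸-monoˡ-< e<i N≤e)))
                    (lds-σ-upper s i)
    ... | is-y  = lds-row-upper 0 N i (evalW σ s)
                    (λ {e} _ e<N _ → begin
                      suc (lds e (evalW σ s))  ≤⟨ s≤s (lds-σ-upper s e) ⟩
                      suc ((e ∸ N) + #y s)     ≡⟨ cong (λ n → suc (n + #y s)) (m≤n⇒m∸n≡0 (<⇒≤ e<N)) ⟩
                      suc (#y s)               ≤⟨ m≤n+m _ (i ∸ N) ⟩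
                      (i ∸ N) + suc (#y s)     ∎)
                    (≤-trans (lds-σ-upper s i) (+-monoʳ-≤ (i ∸ N) (n≤1+n _)))
      where open ≤-Reasoning
    ... | other = lds-σ-upper s i

    lds-σ-lower : ∀ s u' → suc a ≤ #x s → N ≤ #y u' →
                  N + suc a ≤ lds (N + suc a) (evalW σ (s ++ u'))
    lds-σ-lower s u' a<#x N≤#y = begin
      N + suc a                                     ≡⟨ +-comm N (suc a) ⟩
      suc a + N                                     ≤⟨ +-monoʳ-≤ (suc a) (lds-σ-lower-y u' N N≤#y ≤-refl) ⟩
      suc a + lds N (evalW σ u')                    ≤⟨ lds-σ-lower-x s (suc a) (evalW σ u') a<#x ≤-refl ⟩
      lds (N + suc a) (evalW σ s ++ evalW σ u')     ≡⟨ cong (lds (N + suc a)) (concatMap-++ σ s u') ⟨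
      lds (N + suc a) (evalW σ (s ++ u'))           ∎
      where open ≤-Reasoning

    -- After its leading row 0, …, N−1 only N−1 further y-blocks follow, so a decreasing
    -- subsequence below N + c with c ≥ 1 misses at least one of the letters 0, …, N + c − 1.
    lds-σ-tail : ∀ v' → suc (#y v') ≡ N → ∀ i →
                 lds i (row 0 N ++ evalW σ v') ≤ N + pred (i ∸ N)
    lds-σ-tail v' N≡ i = lds-row-upper 0 N i (evalW σ v')
      (λ {e} _ e<N _ → ≤-trans (s≤s (lds-≤-bound e (evalW σ v'))) (≤-trans e<N (m≤m+n N _)))
      (≤-trans (lds-σ-upper v' i)
               (subst (λ n → (i ∸ N) + #y v' ≤ n + pred (i ∸ N)) N≡
                      (+-≤-suc-+-pred (i ∸ N) (#y v'))))

    lds-σ-prefix-upper : ∀ R → (∀ i → lds i R ≤ N + pred (i ∸ N)) →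
                         ∀ s i → lds i (evalW σ s ++ R) ≤ N + (#x s ⊔ pred (i ∸ N))
    lds-σ-prefix-upper R R-bound []      i = R-bound i
    lds-σ-prefix-upper R R-bound (z ∷ s) i rewrite ++-assoc (σ z) (evalW σ s) R with kind z
    ... | is-x  = lds-row-upper N (suc a) i (evalW σ s ++ R)
                    (λ {e} N≤e _ e<i → begin
                      suc (lds e (evalW σ s ++ R))     ≤⟨ s≤s (lds-σ-prefix-upper R R-bound s e) ⟩
                      suc (N + (#x s ⊔ pred (e ∸ N)))  ≡⟨ +-suc N _ ⟨
                      N + suc (#x s ⊔ pred (e ∸ N))
                        ≤⟨ +-monoʳ-≤ N (suc-⊔-pred-mono (#x s) (∸-monoˡ-< e<i N≤e)) ⟩
                      N + (suc (#x s) ⊔ pred (i ∸ N))  ∎)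
                    (≤-trans (lds-σ-prefix-upper R R-bound s i)
                             (+-monoʳ-≤ N (⊔-monoˡ-≤ (pred (i ∸ N)) (n≤1+n (#x s)))))
      where open ≤-Reasoning
    ... | is-y  = lds-row-upper 0 N i (evalW σ s ++ R)
                    (λ {e} _ e<N _ → ≤-trans (s≤s (lds-≤-bound e (evalW σ s ++ R)))
                                             (≤-trans e<N (m≤m+n N _)))
                    (lds-σ-prefix-upper R R-bound s i)
    ... | other = lds-σ-prefix-upper R R-bound s i

    lds-σ-upper-diverging : x ≢ y → ∀ s v' → suc (#y v') ≡ N →
                            lds (N + suc (#x s)) (evalW σ (s ++ y ∷ v')) ≤ N + #x s
    lds-σ-upper-diverging x≢y s v' N≡ = begin
      lds i (evalW σ (s ++ y ∷ v'))
        ≡⟨ cong (lds i) (concatMap-++ σ s (y ∷ v')) ⟩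
      lds i (evalW σ s ++ σ y ++ evalW σ v')
        ≡⟨ cong (λ r → lds i (evalW σ s ++ r ++ evalW σ v')) (σ-y x≢y) ⟩
      lds i (evalW σ s ++ row 0 N ++ evalW σ v')
        ≤⟨ lds-σ-prefix-upper _ (lds-σ-tail v' N≡) s i ⟩
      N + (#x s ⊔ pred (i ∸ N))
        ≡⟨ cong (λ n → N + (#x s ⊔ pred n)) (m+n∸m≡n N (suc (#x s))) ⟩
      N + (#x s ⊔ #x s)
        ≡⟨ cong (N +_) (⊔-idem (#x s)) ⟩
      N + #x s
        ∎
      where
      open ≤-Reasoning
      i = N + suc (#x s)

  #y-after-divergence : x ≢ y → ∀ w u' v' → #y (w ++ x ∷ u') ≡ #y (w ++ y ∷ v') →
                        suc (#y v') ≡ #y u'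
  #y-after-divergence x≢y w u' v' same-#y = begin
    suc (#y v')   ≡⟨ #y-y∷ x≢y v' ⟨
    #y (y ∷ v')   ≡⟨ +-cancelˡ-≡ (#y w) _ _ (trans (sym (#y-++ w (y ∷ v')))
                                              (trans (sym same-#y) (#y-++ w (x ∷ u')))) ⟩
    #y (x ∷ u')   ≡⟨ #y-x∷ u' ⟩
    #y u'         ∎
    where open ≡-Reasoning

  diverging-not-satisfied : x ≢ y → ∀ w u' v' → #y (w ++ x ∷ u') ≡ #y (w ++ y ∷ v') →
                            ¬ PlacSatisfies (w ++ x ∷ u') (w ++ y ∷ v')
  diverging-not-satisfied x≢y w u' v' same-#y sat = n≮n a (+-cancelˡ-≤ N (suc a) a (begin
    N + suc a
      ≤⟨ lds-σ-lower (w ++ x ∷ []) u' (≤-reflexive (sym (#x-∷ʳ-x w))) ≤-refl ⟩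
    lds (N + suc a) (evalW σ ((w ++ x ∷ []) ++ u'))
      ≡⟨ cong (λ s → lds (N + suc a) (evalW σ s)) (++-assoc w (x ∷ []) u') ⟩
    lds (N + suc a) (evalW σ (w ++ x ∷ u'))
      ≡⟨ lds-resp-≈ₚ (sat σ) (N + suc a) ⟩
    lds (N + suc a) (evalW σ (w ++ y ∷ v'))
      ≤⟨ lds-σ-upper-diverging x≢y w v' (#y-after-divergence x≢y w u' v' same-#y) ⟩
    N + a
      ∎))
    where
    a = #x w
    N = #y u'
    open Witness a N
    open ≤-Reasoning

data Divergence : List Var → List Var → Set where
  identical      : ∀ {u} → Divergence u u
  lengths-differ : ∀ {u v} → length u ≢ length v → Divergence u v
  diverge        : ∀ w x y u' v' → x ≢ y → Divergence (w ++ x ∷ u') (w ++ y ∷ v')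

divergence : ∀ u v → Divergence u v
divergence []      []      = identical
divergence []      (_ ∷ _) = lengths-differ (λ ())
divergence (_ ∷ _) []      = lengths-differ (λ ())
divergence (a ∷ u) (b ∷ v) with a ≟ b
... | no a≢b = diverge [] a b u v a≢b
... | yes refl with divergence u v
...   | identical          = identical
...   | lengths-differ ≢ℓ  = lengths-differ (≢ℓ ∘ suc-injective)
...   | diverge w x y u' v' x≢y = diverge (a ∷ w) x y u' v' x≢y

length-evalW-singleton : ∀ s → length (evalW (λ _ → 0 ∷ []) s) ≡ length s
length-evalW-singleton []      = refl
length-evalW-singleton (_ ∷ s) = cong suc (length-evalW-singleton s)

lengths-agree : ∀ u v → PlacSatisfies u v → length u ≡ length v
lengths-agree u v sat = begin
  length u                                ≡⟨ length-evalW-singleton u ⟨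
  length (evalW (λ _ → 0 ∷ []) u)         ≡⟨ length-resp-≈ₚ (sat (λ _ → 0 ∷ [])) ⟩
  length (evalW (λ _ → 0 ∷ []) v)         ≡⟨ length-evalW-singleton v ⟩
  length v                                ∎
  where open ≡-Reasoning

theorem3p2 : (u v : List Var) → u ≢ v → ¬ PlacSatisfies u v
theorem3p2 u v u≢v sat with divergence u v
... | identical                 = u≢v refl
... | lengths-differ ≢ℓ         = ≢ℓ (lengths-agree u v sat)
... | diverge w x y u' v' x≢y   =
  diverging-not-satisfied x≢y w u' v' (#y-agree (w ++ x ∷ u') (w ++ y ∷ v') sat) sat
  where open TwoVariables x y
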